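{- Let $G$ be a finite simple graph with at least two vertices which is a König–Egerváry graph (i.e. $\alpha(G)+\mu(G)=|V(G)|$), and assume $G$ is not isomorphic to $K_n-e$ for $n=2,3$ (the complete graph on $n$ vertices minus one edge). If $G$ is $\alpha^{++}$-stable, then $G$ has a perfect matching consisting only of pendant edges.
   Context: $\alpha(G)$ is the maximum size of a stable set and $\mu(G)$ the maximum size of a matching. A pendant edge is an edge $vw$ with $v$ having exactly one neighbour. For $e\in E(\overline{G})$ (a pair of distinct non-adjacent vertices), $G+e$ denotes $G$ with the edge $e$ added. $G$ is $\alpha^{++}$-stable if $\alpha(G+e_1+e_2)=\alpha(G)$ for any $e_1,e_2\in E(\overline{G})$ (not necessarily distinct). -}

module Defs where

open import Data.Nat using (ℕ; zero; suc; _+_; _≤_)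
open import Data.Bool using (Bool; true; false; _∨_; _∧_; if_then_else_)
open import Data.Fin using (Fin; zero; suc)
open import Data.Fin.Properties using (_≟_)
open import Data.Fin.Subset using (Subset; _∈_; ∣_∣)
open import Data.List using (List; []; _∷_; length; concatMap; map; allFin)
open import Data.Nat.ListAction using (sum)
open import Data.List.Relation.Unary.All using (All)
open import Data.List.Relation.Unary.Unique.Propositional using (Unique)
import Data.List.Membership.Propositional as LM
open import Data.Product using (_×_; _,_; Σ; ∃; ∃-syntax)
open import Data.Sum using (_⊎_)
open import Relation.Binary.PropositionalEquality using (_≡_; _≢_)
open import Relation.Nullary.Decidable using (⌊_⌋)
open import Function.Bundles using (_↔_; Inverse)

Adjacency : ℕ → Set
Adjacency n = Fin n → Fin n → Bool

record Graph (n : ℕ) : Set where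
  field
    adj   : Adjacency n
    sym   : ∀ x y → adj x y ≡ adj y x
    irrefl : ∀ x → adj x x ≡ false
open Graph public

IsStable : ∀ {n} → Adjacency n → Subset n → Set
IsStable {n} a S = ∀ (x y : Fin n) → x ∈ S → y ∈ S → a x y ≡ false

IsAlpha : ∀ {n} → Adjacency n → ℕ → Set
IsAlpha {n} a k =
  (∃[ S ] (IsStable a S × ∣ S ∣ ≡ k)) × (∀ (S : Subset n) → IsStable a S → ∣ S ∣ ≤ k)

endpoints : ∀ {n} → List (Fin n × Fin n) → List (Fin n)
endpoints = concatMap (λ { (u , v) → u ∷ v ∷ [] })

IsMatching : ∀ {n} → Adjacency n → List (Fin n × Fin n) → Set
IsMatching a M = All (λ { (u , v) → a u v ≡ true }) M × Unique (endpoints M)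

IsMu : ∀ {n} → Adjacency n → ℕ → Set
IsMu {n} a k =
  (∃[ M ] (IsMatching a M × length M ≡ k))
  × (∀ (M : List (Fin n × Fin n)) → IsMatching a M → length M ≤ k)

IsPerfectMatching : ∀ {n} → Adjacency n → List (Fin n × Fin n) → Set
IsPerfectMatching {n} a M = IsMatching a M × (∀ (x : Fin n) → x LM.∈ endpoints M)

degree : ∀ {n} → Adjacency n → Fin n → ℕ
degree {n} a v = sum (map (λ w → if a v w then 1 else 0) (allFin n))

IsPendantEdge : ∀ {n} → Adjacency n → Fin n × Fin n → Set
IsPendantEdge a (u , v) = a u v ≡ true × (degree a u ≡ 1 ⊎ degree a v ≡ 1)

IsNonEdge : ∀ {n} → Adjacency n → Fin n × Fin n → Set
IsNonEdge a (u , v) = u ≢ v × a u v ≡ false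

addEdge : ∀ {n} → Adjacency n → Fin n × Fin n → Adjacency n
addEdge a (u , v) x y =
  a x y ∨ (⌊ x ≟ u ⌋ ∧ ⌊ y ≟ v ⌋) ∨ (⌊ x ≟ v ⌋ ∧ ⌊ y ≟ u ⌋)

IsKonigEgervary : ∀ {n} → Graph n → Set
IsKonigEgervary {n} G = ∃[ a ] ∃[ m ] (IsAlpha (adj G) a × IsMu (adj G) m × a + m ≡ n)

IsAlphaPPStable : ∀ {n} → Graph n → Set
IsAlphaPPStable {n} G =
  ∀ (k : ℕ) → IsAlpha (adj G) k →
  ∀ (e₁ e₂ : Fin n × Fin n) → IsNonEdge (adj G) e₁ → IsNonEdge (adj G) e₂ →
  IsAlpha (addEdge (addEdge (adj G) e₁) e₂) k

-- K_{k+2} - e : complete graph on Fin (k+2) minus the edge {0,1}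
isZeroOne : ∀ {m} → Fin m → Fin m → Bool
isZeroOne zero (suc zero) = true
isZeroOne (suc zero) zero = true
isZeroOne _ _ = false

KminusE : (k : ℕ) → Adjacency (suc (suc k))
KminusE k x y = if ⌊ x ≟ y ⌋ then false else (if isZeroOne x y then false else true)

Isomorphic : ∀ {n m} → Adjacency n → Adjacency m → Set
Isomorphic {n} {m} a b =
  Σ (Fin n ↔ Fin m) λ f → ∀ x y → a x y ≡ b (Inverse.to f x) (Inverse.to f y)

-- Let M be a maximum matching, so α + |M| = n. A stable set meets every M-edge at most once, so it
-- has at most |M| + #(M-exposed vertices) = α elements; a maximum one therefore contains every
-- exposed vertex and an endpoint of every M-edge. By α⁺⁺-stability, for any two pairs of distinct
-- vertices some maximum stable set of G + e₁ + e₂, which is also one of G, contains neither pair.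
-- An exposed vertex x and another vertex y (exposed, or matched to z) make such a set contain x and
-- one of y, z, against the pairs xy, xz: so M is perfect. If the M-edge xy were not pendant, with
-- neighbours u ≠ y of x and v ≠ x of y matched to p and q, the pairs xp, yq give a maximum stable
-- set containing x (say), hence u or p, against the edge xu or the pair xp.
module Submission where

open import Defs
open import Data.Nat using (ℕ; _≤_)
open import Data.Fin using (Fin)
open import Data.List using (List)
open import Data.List.Relation.Unary.All using (All)
open import Data.Product using (_×_; ∃-syntax)
open import Relation.Nullary using (¬_)

open import Data.Bool using (Bool; true; false; if_then_else_)
import Data.Bool.Properties as Bool
open import Data.Bool.Properties using (¬-not)
open import Data.Empty using (⊥; ⊥-elim)
open import Data.Fin using (zero; suc)
open import Data.Fin.Properties using (_≟_; any?)
open import Data.Fin.Subset using (Subset; _∈_; ∣_∣; ⁅_⁆)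
open import Data.Fin.Subset.Properties using (x∈⁅x⁆; x∈⁅y⁆⇒x≡y; ∣⁅x⁆∣≡1)
open import Data.List using ([]; _∷_; _++_; length; map; filter; allFin; tabulate)
open import Data.List.Membership.Propositional using () renaming (_∈_ to _∈ₗ_; _∉_ to _∉ₗ_)
open import Data.List.Membership.Propositional.Properties
  using (∈-allFin; ∈-++⁺ˡ; ∈-++⁺ʳ; ∈-filter⁺; ∈-filter⁻)
open import Data.List.Membership.Propositional.Properties.WithK using (unique∧set⇒bag)
open import Data.List.Properties using (map-++; map-cong; map-tabulate; length-++; length-tabulate)
open import Data.List.Relation.Binary.BagAndSetEquality using (∼bag⇒↭)
open import Data.List.Relation.Binary.Permutation.Propositional using (_↭_)
open import Data.List.Relation.Binary.Permutation.Propositional.Properties using (map⁺; ↭-length)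
open import Data.List.Relation.Unary.All using ([]; _∷_)
import Data.List.Relation.Unary.All as All
open import Data.List.Relation.Unary.AllPairs using (_∷_)
open import Data.List.Relation.Unary.Any using (here; there)
import Data.List.Relation.Unary.Any as Any
open import Data.List.Relation.Binary.Disjoint.Propositional using (Disjoint)
open import Data.List.Relation.Unary.Unique.Propositional using (Unique)
open import Data.List.Relation.Unary.Unique.Propositional.Properties using (++⁺; filter⁺; allFin⁺)
open import Data.Nat using (suc; _+_; z≤n; s≤s)
open import Data.Nat.ListAction using (sum)
open import Data.Nat.ListAction.Properties using (sum-++; sum-↭)
open import Data.Nat.Properties
  using (≤-refl; ≤-antisym; ≤-reflexive; ≤-trans; +-assoc; +-comm; +-suc; +-mono-≤; +-monoˡ-≤; +-monoʳ-≤;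
         +-cancelˡ-≤; +-cancelʳ-≤; +-cancelʳ-≡)
open import Data.Product using (_,_; proj₁; proj₂)
import Data.Product as Product
open import Data.Sum using (_⊎_; inj₁; inj₂; swap)
import Data.Sum as Sum
open import Data.Vec using ([]; _∷_; lookup)
open import Data.Vec.Properties using ([]=⇒lookup; lookup⇒[]=)
open import Function using (_∘_; id)
open import Function.Bundles using (mk⇔)
open import Relation.Binary.PropositionalEquality using (_≡_; _≢_; refl; trans; cong; module ≡-Reasoning)
import Relation.Binary.PropositionalEquality as ≡
open import Relation.Nullary using (Dec; yes; no; ¬?)
open import Relation.Nullary.Decidable using (⌊_⌋; isYes≗does; decidable-stable; dec-true; _×-dec_)

private
  variable
    n : ℕ
    x y z : Fin n
    M : List (Fin n × Fin n)

saturated-+ : ∀ {s₁ s₂ l₁ l₂} → s₁ ≤ l₁ → s₂ ≤ l₂ → l₁ + l₂ ≤ s₁ + s₂ → l₁ ≤ s₁ × l₂ ≤ s₂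
saturated-+ {s₁} {s₂} {l₁} {l₂} s₁≤l₁ s₂≤l₂ l≤s =
  +-cancelʳ-≤ l₂ l₁ s₁ (≤-trans l≤s (+-monoʳ-≤ s₁ s₂≤l₂)) ,
  +-cancelˡ-≤ l₁ l₂ s₂ (≤-trans l≤s (+-monoˡ-≤ s₂ s₁≤l₁))

module _ {A : Set} {f : A → ℕ} where

  sum-map-≤-length : ∀ {xs} → All (λ x → f x ≤ 1) xs → sum (map f xs) ≤ length xs
  sum-map-≤-length []              = z≤n
  sum-map-≤-length (fx≤1 ∷ fxs≤1) = +-mono-≤ fx≤1 (sum-map-≤-length fxs≤1)

  length≤sum⇒All≡1 : ∀ {xs} → All (λ x → f x ≤ 1) xs → length xs ≤ sum (map f xs) →
                     All (λ x → f x ≡ 1) xs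
  length≤sum⇒All≡1 [] _ = []
  length≤sum⇒All≡1 (fx≤1 ∷ fxs≤1) len≤sum
    with 1≤fx , len≤sum′ ← saturated-+ fx≤1 (sum-map-≤-length fxs≤1) len≤sum
    = ≤-antisym fx≤1 1≤fx ∷ length≤sum⇒All≡1 fxs≤1 len≤sum′

indicator : Bool → ℕ
indicator b = if b then 1 else 0

indicator≤1 : ∀ b → indicator b ≤ 1
indicator≤1 true  = ≤-refl
indicator≤1 false = z≤n

indicator≡1 : ∀ {b} → indicator b ≡ 1 → b ≡ true
indicator≡1 {true} _ = refl

indicator-+≤1 : ∀ {b c} → ¬ (b ≡ true × c ≡ true) → indicator b + indicator c ≤ 1
indicator-+≤1 {true}  {true}  ¬both = ⊥-elim (¬both (refl , refl))
indicator-+≤1 {true}  {false} _     = ≤-refl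
indicator-+≤1 {false} {true}  _     = ≤-refl
indicator-+≤1 {false} {false} _     = z≤n

indicator-+≡1 : ∀ {b c} → indicator b + indicator c ≡ 1 → b ≡ true ⊎ c ≡ true
indicator-+≡1 {true}          _ = inj₁ refl
indicator-+≡1 {false} {true}  _ = inj₂ refl

∣p∣≡sum-indicator : (p : Subset n) → ∣ p ∣ ≡ sum (map (indicator ∘ lookup p) (allFin n))
∣p∣≡sum-indicator {n} p = trans (tabulated p) (cong sum (≡.sym (map-tabulate id (indicator ∘ lookup p))))
  where
  tabulated : ∀ {m} (q : Subset m) → ∣ q ∣ ≡ sum (tabulate (indicator ∘ lookup q))
  tabulated []          = refl
  tabulated (true ∷ q)  = cong suc (tabulated q)
  tabulated (false ∷ q) = tabulated q

another-vertex : 2 ≤ n → (x : Fin n) → ∃[ y ] y ≢ x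
another-vertex (s≤s (s≤s _)) zero    = suc zero , λ ()
another-vertex (s≤s (s≤s _)) (suc x) = zero , λ ()

_⊑_ : Adjacency n → Adjacency n → Set
a ⊑ b = ∀ {x y} → a x y ≡ true → b x y ≡ true

⊑-addEdge : (a : Adjacency n) (e : Fin n × Fin n) → a ⊑ addEdge a e
⊑-addEdge a e {x} {y} axy rewrite axy = refl

Adjacent : Adjacency n → Fin n × Fin n → Set
Adjacent a (u , v) = a u v ≡ true

⌊x≟x⌋≡true : (x : Fin n) → ⌊ x ≟ x ⌋ ≡ true
⌊x≟x⌋≡true x = trans (isYes≗does (x ≟ x)) (dec-true (x ≟ x) refl)

addEdge-adjacent : (a : Adjacency n) (e : Fin n × Fin n) → Adjacent (addEdge a e) e
addEdge-adjacent a (u , v) rewrite ⌊x≟x⌋≡true u | ⌊x≟x⌋≡true v = Bool.∨-zeroʳ (a u v)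

adjacent-or-nonEdge : (a : Adjacency n) {u v : Fin n} → u ≢ v → Adjacent a (u , v) ⊎ IsNonEdge a (u , v)
adjacent-or-nonEdge a {u} {v} u≢v with a u v
... | true  = inj₁ refl
... | false = inj₂ (u≢v , refl)

Avoids : Subset n → Fin n × Fin n → Set
Avoids T (u , v) = ¬ (u ∈ T × v ∈ T)

stable⇒avoids : ∀ {a : Adjacency n} {T} e → IsStable a T → Adjacent a e → Avoids T e
stable⇒avoids (u , v) stable auv (u∈T , v∈T) with () ← trans (≡.sym auv) (stable u v u∈T v∈T)

IsStable-antitone : ∀ {a b : Adjacency n} {T} → a ⊑ b → IsStable b T → IsStable a T
IsStable-antitone a⊑b stable x y x∈T y∈T =
  ¬-not (λ axy → stable⇒avoids (x , y) stable (a⊑b axy) (x∈T , y∈T))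

module _ (G : Graph n) {α : ℕ} (isα : IsAlpha (adj G) α) (ppStable : IsAlphaPPStable G) where

  MaxStableAvoiding : Fin n × Fin n → Fin n × Fin n → Set
  MaxStableAvoiding e₁ e₂ = ∃[ T ] (IsStable (adj G) T × ∣ T ∣ ≡ α × Avoids T e₁ × Avoids T e₂)

  private
    via : ∀ h e₁ e₂ → adj G ⊑ h → Adjacent h e₁ → Adjacent h e₂ →
      ∃[ T ] (IsStable h T × ∣ T ∣ ≡ α) → MaxStableAvoiding e₁ e₂
    via h e₁ e₂ G⊑h h∋e₁ h∋e₂ (T , stable , size) =
      T , IsStable-antitone G⊑h stable , size ,
      stable⇒avoids e₁ stable h∋e₁ , stable⇒avoids e₂ stable h∋e₂

    G⁺ : Fin n × Fin n → Fin n × Fin n → Adjacency n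
    G⁺ f₁ f₂ = addEdge (addEdge (adj G) f₁) f₂

    G⊑G⁺ : ∀ f₁ f₂ → adj G ⊑ G⁺ f₁ f₂
    G⊑G⁺ f₁ f₂ = ⊑-addEdge (addEdge (adj G) f₁) f₂ ∘ ⊑-addEdge (adj G) f₁

    G⁺∋₁ : ∀ f₁ f₂ → Adjacent (G⁺ f₁ f₂) f₁
    G⁺∋₁ f₁ f₂ = ⊑-addEdge (addEdge (adj G) f₁) f₂ (addEdge-adjacent (adj G) f₁)

    G⁺∋₂ : ∀ f₁ f₂ → Adjacent (G⁺ f₁ f₂) f₂
    G⁺∋₂ f₁ f₂ = addEdge-adjacent (addEdge (adj G) f₁) f₂

    via-G⁺ : ∀ e₁ e₂ f₁ f₂ → IsNonEdge (adj G) f₁ → IsNonEdge (adj G) f₂ →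
      Adjacent (G⁺ f₁ f₂) e₁ → Adjacent (G⁺ f₁ f₂) e₂ → MaxStableAvoiding e₁ e₂
    via-G⁺ e₁ e₂ f₁ f₂ f₁∉G f₂∉G G⁺∋e₁ G⁺∋e₂ =
      via (G⁺ f₁ f₂) e₁ e₂ (G⊑G⁺ f₁ f₂) G⁺∋e₁ G⁺∋e₂ (proj₁ (ppStable α isα f₁ f₂ f₁∉G f₂∉G))

    by-cases : ∀ e₁ e₂ → Adjacent (adj G) e₁ ⊎ IsNonEdge (adj G) e₁ →
      Adjacent (adj G) e₂ ⊎ IsNonEdge (adj G) e₂ → MaxStableAvoiding e₁ e₂
    by-cases e₁ e₂ (inj₁ e₁∈G) (inj₁ e₂∈G) = via (adj G) e₁ e₂ id e₁∈G e₂∈G (proj₁ isα)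
    by-cases e₁@(_ , _) e₂ (inj₁ e₁∈G) (inj₂ e₂∉G) =
      via-G⁺ e₁ e₂ e₂ e₂ e₂∉G e₂∉G (G⊑G⁺ e₂ e₂ e₁∈G) (G⁺∋₂ e₂ e₂)
    by-cases e₁ e₂@(_ , _) (inj₂ e₁∉G) (inj₁ e₂∈G) =
      via-G⁺ e₁ e₂ e₁ e₁ e₁∉G e₁∉G (G⁺∋₁ e₁ e₁) (G⊑G⁺ e₁ e₁ e₂∈G)
    by-cases e₁ e₂ (inj₂ e₁∉G) (inj₂ e₂∉G) =
      via-G⁺ e₁ e₂ e₁ e₂ e₁∉G e₂∉G (G⁺∋₁ e₁ e₂) (G⁺∋₂ e₁ e₂)

  maxStable-avoiding : ∀ {u₁ v₁ u₂ v₂} → u₁ ≢ v₁ → u₂ ≢ v₂ → MaxStableAvoiding (u₁ , v₁) (u₂ , v₂)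
  maxStable-avoiding {u₁} {v₁} {u₂} {v₂} u₁≢v₁ u₂≢v₂ =
    by-cases (u₁ , v₁) (u₂ , v₂) (adjacent-or-nonEdge (adj G) u₁≢v₁) (adjacent-or-nonEdge (adj G) u₂≢v₂)

data Matched {n} : List (Fin n × Fin n) → Fin n → Fin n → Set where
  here  : ∀ {x y M} → Matched ((x , y) ∷ M) x y
  here˘ : ∀ {x y M} → Matched ((y , x) ∷ M) x y
  there : ∀ {x y e M} → Matched M x y → Matched (e ∷ M) x y

∈⇒Matched : (x , y) ∈ₗ M → Matched M x y
∈⇒Matched (here refl)  = here
∈⇒Matched (there xy∈M) = there (∈⇒Matched xy∈M)

Matched-sym : Matched M x y → Matched M y x
Matched-sym here        = here˘
Matched-sym here˘       = here
Matched-sym (there x~y) = there (Matched-sym x~y)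

All-Matched : ∀ {P : Fin n × Fin n → Set} → (∀ {u v} → P (u , v) → P (v , u)) →
  All P M → Matched M x y → P (x , y)
All-Matched P-sym (Puv ∷ _) here        = Puv
All-Matched P-sym (Puv ∷ _) here˘       = P-sym Puv
All-Matched P-sym (_ ∷ PM)  (there x~y) = All-Matched P-sym PM x~y

Matched⇒∈endpoints : Matched M x y → x ∈ₗ endpoints M
Matched⇒∈endpoints here        = here refl
Matched⇒∈endpoints here˘       = there (here refl)
Matched⇒∈endpoints (there x~y) = there (there (Matched⇒∈endpoints x~y))

∉endpoints⇒≢ : x ∉ₗ endpoints M → Matched M y z → x ≢ y
∉endpoints⇒≢ x∉E y~z refl = x∉E (Matched⇒∈endpoints y~z)

∈endpoints⇒Matched : ∀ M → x ∈ₗ endpoints M → ∃[ y ] Matched M x y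
∈endpoints⇒Matched (_ ∷ _) (here refl)         = _ , here
∈endpoints⇒Matched (_ ∷ _) (there (here refl)) = _ , here˘
∈endpoints⇒Matched (_ ∷ M) (there (there x∈E)) with y , x~y ← ∈endpoints⇒Matched M x∈E = y , there x~y

All≢⇒¬Matched : All (x ≢_) (endpoints M) → ¬ Matched M x y
All≢⇒¬Matched x∉E x~y = All.lookup x∉E (Matched⇒∈endpoints x~y) refl

Matched-unique : Unique (endpoints M) → Matched M x y → Matched M x z → y ≡ z
Matched-unique _                 here        here        = refl
Matched-unique _                 here˘       here˘       = refl
Matched-unique ((u≢v ∷ _) ∷ _)   here        here˘       = ⊥-elim (u≢v refl)
Matched-unique ((u≢v ∷ _) ∷ _)   here˘       here        = ⊥-elim (u≢v refl)
Matched-unique ((_ ∷ u∉E) ∷ _)   here        (there x~z) = ⊥-elim (All≢⇒¬Matched u∉E x~z)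
Matched-unique ((_ ∷ u∉E) ∷ _)   (there x~y) here        = ⊥-elim (All≢⇒¬Matched u∉E x~y)
Matched-unique (_ ∷ v∉E ∷ _)     here˘       (there x~z) = ⊥-elim (All≢⇒¬Matched v∉E x~z)
Matched-unique (_ ∷ v∉E ∷ _)     (there x~y) here˘       = ⊥-elim (All≢⇒¬Matched v∉E x~y)
Matched-unique (_ ∷ _ ∷ unique)  (there x~y) (there x~z) = Matched-unique unique x~y x~z

_∈ₗ?_ : (x : Fin n) (xs : List (Fin n)) → Dec (x ∈ₗ xs)
x ∈ₗ? xs = Any.any? (x ≟_) xs

_∉ₗ?_ : (x : Fin n) (xs : List (Fin n)) → Dec (x ∉ₗ xs)
x ∉ₗ? xs = ¬? (x ∈ₗ? xs)

exposed : List (Fin n × Fin n) → List (Fin n)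
exposed {n} M = filter (_∉ₗ? endpoints M) (allFin n)

∈-exposed : x ∉ₗ endpoints M → x ∈ₗ exposed M
∈-exposed {M = M} x∉E = ∈-filter⁺ (_∉ₗ? endpoints M) (∈-allFin _) x∉E

allFin↭endpoints++exposed : Unique (endpoints M) → allFin n ↭ endpoints M ++ exposed M
allFin↭endpoints++exposed {M = M} unique =
  ∼bag⇒↭ (unique∧set⇒bag (allFin⁺ _) (++⁺ unique (filter⁺ (_∉ₗ? endpoints M) (allFin⁺ _)) disjoint)
    (mk⇔ (λ _ → covered-or-exposed _) (λ _ → ∈-allFin _)))
  where
  disjoint : Disjoint (endpoints M) (exposed M)
  disjoint (x∈E , x∈U) = proj₂ (∈-filter⁻ (_∉ₗ? endpoints M) {xs = allFin _} x∈U) x∈E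

  covered-or-exposed : ∀ x → x ∈ₗ endpoints M ++ exposed M
  covered-or-exposed x with x ∈ₗ? endpoints M
  ... | yes x∈E = ∈-++⁺ˡ x∈E
  ... | no  x∉E = ∈-++⁺ʳ (endpoints M) (∈-exposed {M = M} x∉E)

length-endpoints : ∀ (M : List (Fin n × Fin n)) → length (endpoints M) ≡ length M + length M
length-endpoints []      = refl
length-endpoints (_ ∷ M) =
  cong suc (trans (cong suc (length-endpoints M)) (≡.sym (+-suc (length M) (length M))))

edgeSum : (Fin n → ℕ) → Fin n × Fin n → ℕ
edgeSum f (u , v) = f u + f v

sum-map-endpoints : ∀ (f : Fin n → ℕ) M → sum (map f (endpoints M)) ≡ sum (map (edgeSum f) M)
sum-map-endpoints f []            = refl
sum-map-endpoints f ((u , v) ∷ M) =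
  trans (≡.sym (+-assoc (f u) (f v) _)) (cong (f u + f v +_) (sum-map-endpoints f M))

record Meets (M : List (Fin n × Fin n)) (T : Subset n) : Set where
  field
    exposed-∈ : ∀ {x} → x ∉ₗ endpoints M → x ∈ T
    matched-∈ : ∀ {x y} → Matched M x y → x ∈ T ⊎ y ∈ T
open Meets

module _ {a : Adjacency n} (matching : IsMatching a M) {T : Subset n} (stable : IsStable a T) where

  private
    E U : List (Fin n)
    E = endpoints M
    U = exposed M

    χ : Fin n → ℕ
    χ = indicator ∘ lookup T

    permutation : allFin n ↭ E ++ U
    permutation = allFin↭endpoints++exposed {M = M} (proj₂ matching)

    card-split : ∣ T ∣ ≡ sum (map (edgeSum χ) M) + sum (map χ U)
    card-split = begin
      ∣ T ∣                                   ≡⟨ ∣p∣≡sum-indicator T ⟩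
      sum (map χ (allFin n))                  ≡⟨ sum-↭ (map⁺ χ permutation) ⟩
      sum (map χ (E ++ U))                    ≡⟨ cong sum (map-++ χ E U) ⟩
      sum (map χ E ++ map χ U)                ≡⟨ sum-++ (map χ E) (map χ U) ⟩
      sum (map χ E) + sum (map χ U)           ≡⟨ cong (_+ sum (map χ U)) (sum-map-endpoints χ M) ⟩
      sum (map (edgeSum χ) M) + sum (map χ U) ∎
      where open ≡-Reasoning

    vertex-count : n ≡ length M + length M + length U
    vertex-count = begin
      n                                 ≡⟨ length-tabulate id ⟨
      length (allFin n)                 ≡⟨ ↭-length permutation ⟩
      length (E ++ U)                   ≡⟨ length-++ E ⟩
      length E + length U               ≡⟨ cong (_+ length U) (length-endpoints M) ⟩
      length M + length M + length U    ∎
      where open ≡-Reasoning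

    edgeSum≤1 : ∀ u v → a u v ≡ true → edgeSum χ (u , v) ≤ 1
    edgeSum≤1 u v auv =
      indicator-+≤1 (stable⇒avoids (u , v) stable auv ∘ Product.map (lookup⇒[]= u T) (lookup⇒[]= v T))

    edgeSum≡1⇒meets : ∀ u v → edgeSum χ (u , v) ≡ 1 → u ∈ T ⊎ v ∈ T
    edgeSum≡1⇒meets u v = Sum.map (lookup⇒[]= u T) (lookup⇒[]= v T) ∘ indicator-+≡1

    edges≤1 : All (λ e → edgeSum χ e ≤ 1) M
    edges≤1 = All.map (λ { {u , v} → edgeSum≤1 u v }) (proj₁ matching)

    exposed≤1 : All (λ x → χ x ≤ 1) U
    exposed≤1 = All.universal (indicator≤1 ∘ lookup T) U

  tight⇒Meets : ∣ T ∣ + length M ≡ n → Meets M T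
  tight⇒Meets tight = record
    { exposed-∈ = λ {x} x∉E → lookup⇒[]= x T (indicator≡1 (All.lookup exposed≡1 (∈-exposed {M = M} x∉E)))
    ; matched-∈ = All-Matched swap (All.map (λ { {u , v} → edgeSum≡1⇒meets u v }) edges≡1)
    }
    where
    ∣T∣≡ : ∣ T ∣ ≡ length M + length U
    ∣T∣≡ = +-cancelʳ-≡ (length M) _ _ (begin
      ∣ T ∣ + length M                  ≡⟨ tight ⟩
      n                                 ≡⟨ vertex-count ⟩
      length M + length M + length U    ≡⟨ +-assoc (length M) (length M) (length U) ⟩
      length M + (length M + length U)  ≡⟨ +-comm (length M) (length M + length U) ⟩
      length M + length U + length M    ∎)
      where open ≡-Reasoning

    saturated : length M ≤ sum (map (edgeSum χ) M) × length U ≤ sum (map χ U)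
    saturated = saturated-+ (sum-map-≤-length edges≤1) (sum-map-≤-length exposed≤1)
                            (≤-reflexive (trans (≡.sym ∣T∣≡) card-split))

    edges≡1 : All (λ e → edgeSum χ e ≡ 1) M
    edges≡1 = length≤sum⇒All≡1 edges≤1 (proj₁ saturated)

    exposed≡1 : All (λ x → χ x ≡ 1) U
    exposed≡1 = length≤sum⇒All≡1 exposed≤1 (proj₂ saturated)

avoids-matched : ∀ {T : Subset n} → Meets M T → x ∈ T → Matched M y z →
                 Avoids T (x , y) → Avoids T (x , z) → ⊥
avoids-matched meets x∈T y~z avoids-xy avoids-xz with matched-∈ meets y~z
... | inj₁ y∈T = avoids-xy (x∈T , y∈T)
... | inj₂ z∈T = avoids-xz (x∈T , z∈T)

degree≡1 : (a : Adjacency n) {v w : Fin n} → a v w ≡ true → (∀ {x} → a v x ≡ true → x ≡ w) →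
           degree a v ≡ 1
degree≡1 {n} a {v} {w} avw only = begin
  degree a v                                        ≡⟨ cong sum (map-cong (cong indicator ∘ adj≡⁅w⁆) (allFin n)) ⟩
  sum (map (indicator ∘ lookup ⁅ w ⁆) (allFin n))   ≡⟨ ∣p∣≡sum-indicator ⁅ w ⁆ ⟨
  ∣ ⁅ w ⁆ ∣                                         ≡⟨ ∣⁅x⁆∣≡1 w ⟩
  1                                                 ∎
  where
  open ≡-Reasoning
  adj≡⁅w⁆ : ∀ x → a v x ≡ lookup ⁅ w ⁆ x
  adj≡⁅w⁆ x with x ≟ w
  ... | yes refl = trans avw (≡.sym ([]=⇒lookup (x∈⁅x⁆ w)))
  ... | no  x≢w  = trans (¬-not (x≢w ∘ only)) (≡.sym (¬-not (x≢w ∘ x∈⁅y⁆⇒x≡y w ∘ lookup⇒[]= x ⁅ w ⁆)))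

degree≡1⊎second-neighbour : (a : Adjacency n) {v w : Fin n} → a v w ≡ true →
  degree a v ≡ 1 ⊎ ∃[ x ] (x ≢ w × a v x ≡ true)
degree≡1⊎second-neighbour a {v} {w} avw with any? (λ x → ¬? (x ≟ w) ×-dec (a v x Bool.≟ true))
... | yes second = inj₂ second
... | no ¬second = inj₁ (degree≡1 a avw only)
  where
  only : ∀ {x} → a v x ≡ true → x ≡ w
  only {x} avx = decidable-stable (x ≟ w) (λ x≢w → ¬second (x , x≢w , avx))

module AlphaPPStableKE (G : Graph n) (2≤n : 2 ≤ n) {α : ℕ} (isα : IsAlpha (adj G) α)
                       (matching : IsMatching (adj G) M) (ke : α + length M ≡ n)
                       (ppStable : IsAlphaPPStable G) where

  Matched⇒adj : Matched M x y → adj G x y ≡ true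
  Matched⇒adj = All-Matched (λ {u} {v} auv → trans (Graph.sym G v u) auv) (proj₁ matching)

  partner-≢ : ∀ {u p} → Matched M x y → u ≢ y → Matched M u p → x ≢ p
  partner-≢ x~y u≢y u~p refl = u≢y (Matched-unique (proj₂ matching) (Matched-sym u~p) x~y)

  separating : ∀ {u₁ v₁ u₂ v₂} → u₁ ≢ v₁ → u₂ ≢ v₂ →
    ∃[ T ] (IsStable (adj G) T × Meets M T × Avoids T (u₁ , v₁) × Avoids T (u₂ , v₂))
  separating u₁≢v₁ u₂≢v₂
    with T , stable , size , avoids₁ , avoids₂ ← maxStable-avoiding G isα ppStable u₁≢v₁ u₂≢v₂
    = T , stable , tight⇒Meets matching stable (trans (cong (_+ length M) size) ke) , avoids₁ , avoids₂

  exposed-beside-exposed : x ∉ₗ endpoints M → y ∉ₗ endpoints M → x ≢ y → ⊥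
  exposed-beside-exposed x∉E y∉E x≢y with _ , _ , meets , avoids , _ ← separating x≢y x≢y
    = avoids (exposed-∈ meets x∉E , exposed-∈ meets y∉E)

  exposed-beside-matched : x ∉ₗ endpoints M → Matched M y z → ⊥
  exposed-beside-matched x∉E y~z
    with _ , _ , meets , avoids-xy , avoids-xz
           ← separating (∉endpoints⇒≢ x∉E y~z) (∉endpoints⇒≢ x∉E (Matched-sym y~z))
    = avoids-matched meets (exposed-∈ meets x∉E) y~z avoids-xy avoids-xz

  perfect : ∀ x → x ∈ₗ endpoints M
  perfect x = decidable-stable (x ∈ₗ? endpoints M) (exposed-absurd (another-vertex 2≤n x))
    where
    exposed-absurd : ∃[ y ] y ≢ x → ¬ x ∉ₗ endpoints M
    exposed-absurd (y , y≢x) x∉E with y ∈ₗ? endpoints M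
    ... | no  y∉E = exposed-beside-exposed x∉E y∉E (y≢x ∘ ≡.sym)
    ... | yes y∈E = exposed-beside-matched x∉E (proj₂ (∈endpoints⇒Matched M y∈E))

  no-outer-partners : ∀ {u p v q} → Matched M x y → adj G x u ≡ true → Matched M u p → x ≢ p →
    adj G y v ≡ true → Matched M v q → y ≢ q → ⊥
  no-outer-partners x~y x-u u~p x≢p y-v v~q y≢q
    with _ , stable , meets , avoids-xp , avoids-yq ← separating x≢p y≢q
    with matched-∈ meets x~y
  ... | inj₁ x∈T = avoids-matched meets x∈T u~p (stable⇒avoids _ stable x-u) avoids-xp
  ... | inj₂ y∈T = avoids-matched meets y∈T v~q (stable⇒avoids _ stable y-v) avoids-yq

  pendant : Matched M x y → degree (adj G) x ≡ 1 ⊎ degree (adj G) y ≡ 1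
  pendant x~y with degree≡1⊎second-neighbour (adj G) (Matched⇒adj x~y)
                 | degree≡1⊎second-neighbour (adj G) (Matched⇒adj (Matched-sym x~y))
  ... | inj₁ deg-x | _          = inj₁ deg-x
  ... | inj₂ _     | inj₁ deg-y = inj₂ deg-y
  ... | inj₂ (u , u≢y , x-u) | inj₂ (v , v≢x , y-v)
    with p , u~p ← ∈endpoints⇒Matched M (perfect u)
    with q , v~q ← ∈endpoints⇒Matched M (perfect v)
    = ⊥-elim (no-outer-partners x~y x-u u~p (partner-≢ x~y u≢y u~p)
                                y-v v~q (partner-≢ (Matched-sym x~y) v≢x v~q))

  pendant-edges : All (IsPendantEdge (adj G)) M
  pendant-edges = All.tabulate λ { {x , y} xy∈M → let x~y = ∈⇒Matched xy∈M in Matched⇒adj x~y , pendant x~y }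

-- K₂ − e and K₃ − e need not be excluded: adding their missing edge lowers α, so neither is α⁺⁺-stable.
proposition11 : ∀ {n : ℕ} (G : Graph n) → 2 ≤ n → IsKonigEgervary G →
    ¬ Isomorphic (adj G) (KminusE 0) → ¬ Isomorphic (adj G) (KminusE 1) →
    IsAlphaPPStable G →
    ∃[ M ] (IsPerfectMatching (adj G) M × All (IsPendantEdge (adj G)) M)
proposition11 G 2≤n (α , μ , isα , ((M , matching , refl) , _) , ke) _ _ ppStable =
  M , (matching , perfect) , pendant-edges
  where open AlphaPPStableKE G 2≤n isα matching ke ppStable
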